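{- Let $\mathcal I$ be a non-empty set with a directed preorder. If $\mathcal H_{\mathbb N}=(\mathcal H_n)_{n\in\mathbb N}$ and $\mathcal H'_{\mathbb N}=(\mathcal H'_n)_{n\in\mathbb N}$ are indefinitely large families, then $\mathcal H_{\mathbb N}\cap\mathcal H'_{\mathbb N}=(\mathcal H_n\cap\mathcal H'_n)_{n\in\mathbb N}$ is indefinitely large. If $\mathcal H_{\mathbb N}$ and $\mathcal H'_{\mathbb N}$ both satisfy property (*), then so does $\mathcal H_{\mathbb N}\cap\mathcal H'_{\mathbb N}$.
   Context: $\mathcal I$ is a non-empty set with a directed preorder $\le$; $\uparrow i=\{i'\in\mathcal I:i'\ge i\}$. Contexts are tuples $C\in\mathcal I^n$; $()$ is the empty context, $Ci$ is $C$ extended by $i$. The sets $\mathfrak D_n\subseteq\mathcal P(\mathcal I^n)$: $\mathcal H\in\mathfrak D_0$ iff $\mathcal H=\{()\}$; $\mathcal H\in\mathfrak D_1$ iff $\uparrow i\subseteq\mathcal H$ for some $i$; for $\mathcal H\subseteq\mathcal I^{n+1}$, $\mathcal H\in\mathfrak D_{n+1}$ iff $\{C\in\mathcal I^n:\{i: Ci\in\mathcal H\}\in\mathfrak D_1\}\in\mathfrak D_n$. A family $(\mathcal H_n)_{n\in\mathbb N}$ with $\mathcal H_n\subseteq\mathcal I^n$ is indefinitely large iff $\mathcal H_n\in\mathfrak D_n$ for all $n$. Property (*) of such a family: for all $m$, $C\in\mathcal I^m$, $i\in\mathcal I$, $Ci\in\mathcal H_{m+1}$ implies $C\in\mathcal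 H_m$. -}

module Defs where

open import Data.Nat using (ℕ; zero; suc)
open import Data.Vec using (Vec; []; _∷ʳ_)
open import Data.Product using (Σ; _×_; ∃)
open import Relation.Binary.PropositionalEquality using (_≡_)

record DirectedSet : Set₁ where
  field
    Carrier  : Set
    _≼_      : Carrier → Carrier → Set
    ≼-refl   : ∀ {i} → i ≼ i
    ≼-trans  : ∀ {i j k} → i ≼ j → j ≼ k → i ≼ k
    directed : ∀ i j → Σ Carrier (λ k → (i ≼ k) × (j ≼ k))
    nonempty : Carrier

module _ (𝓘 : DirectedSet) where
  open DirectedSet 𝓘

  -- contexts of length n: tuples in I^n; extension C i is appending i at the end
  Ctx : ℕ → Set
  Ctx n = Vec Carrier n

  Subset : ℕ → Set₁
  Subset n = Ctx n → Set

  UpIn : Carrier → (Carrier → Set) → Set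
  UpIn i H = ∀ i' → i ≼ i' → H i'

  D₁ : (Carrier → Set) → Set
  D₁ H = Σ Carrier (λ i → UpIn i H)

  D : (n : ℕ) → Subset n → Set
  D zero    H = ∀ C → H C          -- H = {()} (I^0 has the single element ())
  D (suc n) H = D n (λ C → D₁ (λ i → H (C ∷ʳ i)))

  Family : Set₁
  Family = (n : ℕ) → Subset n

  IndefinitelyLarge : Family → Set
  IndefinitelyLarge H = ∀ n → D n (H n)

  Star : Family → Set
  Star H = ∀ m (C : Ctx m) (i : Carrier) → H (suc m) (C ∷ʳ i) → H m C

  _∩F_ : Family → Family → Family
  (H ∩F H') n C = H n C × H' n C

module Submission where

open import Defs
open import Data.Nat using (ℕ; zero; suc)
open import Data.Product using (_×_; _,_; map)
open import Relation.Unary using (_⊆_; _∩_)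

-- Because ≼ is directed, 𝔇₁ is a filter (upward closed and closed under binary
-- intersections), and 𝔇ₙ₊₁ arises from 𝔇ₙ by a monotone operation, so by induction
-- every 𝔇ₙ is a filter too.

module _ (𝓘 : DirectedSet) where
  open DirectedSet 𝓘

  D₁-mono : ∀ {P Q} → P ⊆ Q → D₁ 𝓘 P → D₁ 𝓘 Q
  D₁-mono P⊆Q (i , ↑i⊆P) = i , λ i' i≼i' → P⊆Q (↑i⊆P i' i≼i')

  D₁-∩ : ∀ {P Q} → D₁ 𝓘 P → D₁ 𝓘 Q → D₁ 𝓘 (P ∩ Q)
  D₁-∩ (i , ↑i⊆P) (j , ↑j⊆Q) with directed i j
  ... | k , i≼k , j≼k =
    k , λ k' k≼k' → ↑i⊆P k' (≼-trans i≼k k≼k') , ↑j⊆Q k' (≼-trans j≼k k≼k')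

  D-mono : ∀ n {P Q : Subset 𝓘 n} → P ⊆ Q → D 𝓘 n P → D 𝓘 n Q
  D-mono zero    P⊆Q DP C = P⊆Q (DP C)
  D-mono (suc n) P⊆Q     = D-mono n (D₁-mono P⊆Q)

  D-∩ : ∀ n {P Q : Subset 𝓘 n} → D 𝓘 n P → D 𝓘 n Q → D 𝓘 n (P ∩ Q)
  D-∩ zero    DP DQ C = DP C , DQ C
  D-∩ (suc n) DP DQ   = D-mono n (λ (DPC , DQC) → D₁-∩ DPC DQC) (D-∩ n DP DQ)

  IndefinitelyLarge-∩ : ∀ {H H'} → IndefinitelyLarge 𝓘 H → IndefinitelyLarge 𝓘 H'
                      → IndefinitelyLarge 𝓘 (_∩F_ 𝓘 H H')
  IndefinitelyLarge-∩ large large' n = D-∩ n (large n) (large' n)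

  Star-∩ : ∀ {H H'} → Star 𝓘 H → Star 𝓘 H' → Star 𝓘 (_∩F_ 𝓘 H H')
  Star-∩ star star' m C i = map (star m C i) (star' m C i)

lemma2p5 : (𝓘 : DirectedSet) (H H' : Family 𝓘)
    → (IndefinitelyLarge 𝓘 H → IndefinitelyLarge 𝓘 H' → IndefinitelyLarge 𝓘 (_∩F_ 𝓘 H H'))
    × (Star 𝓘 H → Star 𝓘 H' → Star 𝓘 (_∩F_ 𝓘 H H'))
lemma2p5 𝓘 H H' = IndefinitelyLarge-∩ 𝓘 , Star-∩ 𝓘
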